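{- For $r\in\{0,1\}$ let $u_r(m)$ be the number of permutations of $[m]$ with exactly $r$ occurrences of the pattern $12\text{ - }3$, and $u_r(n;i)$ the number of such permutations $a_1\cdots a_n$ of $[n]$ with $a_1=i$. If $1\le i\le n-2$, then $$u_1(n;i)=\sum_{j=0}^{i-1}\binom{i-1}{j}u_1(n-2-j)+u_0(n;i).$$
   Context: An occurrence of the pattern $12\text{ - }3$ in a permutation $a_1a_2\cdots a_n$ is a pair of indices $(i,j)$ with $i+1<j\le n$ such that $a_i<a_{i+1}<a_j$. The empty permutation has no occurrences. -}

module Defs where

open import Data.Nat using (ℕ; zero; suc; _+_; _<_; _<?_; _≟_)
open import Data.List using (List; []; _∷_; length; filter; map; concatMap)
open import Data.List.Relation.Unary.Unique.Propositional using (Unique)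
open import Data.List.Relation.Unary.Unique.DecPropositional _≟_ using (unique?)
open import Data.Product using (_×_)
open import Relation.Binary.PropositionalEquality using (_≡_)
open import Relation.Nullary using (Dec; yes; no; does)
open import Data.Bool using (if_then_else_)
open import Relation.Nullary.Decidable using (_×-dec_)

range1 : ℕ → List ℕ
range1 zero = []
range1 (suc n) = Data.List._++_ (range1 n) (suc n ∷ [])

words : ℕ → ℕ → List (List ℕ)
words zero n = [] ∷ []
words (suc k) n = concatMap (λ a → map (a ∷_) (words k n)) (range1 n)

IsPerm : List ℕ → Set
IsPerm w = Unique w

perms : ℕ → List (List ℕ)
perms n = filter (λ w → unique? w) (words n n)

countAbove : ℕ → List ℕ → ℕ
countAbove b [] = 0
countAbove b (c ∷ cs) with b <? c
... | yes _ = suc (countAbove b cs)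
... | no _ = countAbove b cs

-- number of occurrences of 12-3: pairs (i,j), i+1<j, a_i < a_{i+1} < a_j
-- occFrom a rest : occurrences in the word a ∷ rest
occFrom : ℕ → List ℕ → ℕ
occFrom a [] = 0
occFrom a (b ∷ rest) = (if does (a <? b) then countAbove b rest else 0) + occFrom b rest

occ12-3 : List ℕ → ℕ
occ12-3 [] = 0
occ12-3 (a ∷ rest) = occFrom a rest

FirstIs : ℕ → List ℕ → Set
FirstIs i [] = i ≡ 0 × (i ≡ suc 0)   -- empty: never holds
FirstIs i (a ∷ _) = a ≡ i

firstIs? : ∀ i w → Dec (FirstIs i w)
firstIs? i [] = i ≟ 0 ×-dec i ≟ 1
firstIs? i (a ∷ _) = a ≟ i

u : ℕ → ℕ → ℕ
u r m = length (filter (λ w → occ12-3 w ≟ r) (perms m))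

u' : ℕ → ℕ → ℕ → ℕ
u' r n i = length (filter (λ w → (occ12-3 w ≟ r) ×-dec firstIs? i w) (perms n))

-- A permutation of [n + 1] with first letter c is c followed by a unique permutation w of [n]
-- whose letters ≥ c are raised by one. Raising keeps the relative order, so the only new
-- occurrences of 12-3 are the pairs (1, j): none if the first letter d of w is below c, and one
-- for each of the n ∸ d letters above d otherwise. For r ≤ 1 and 1 ≤ c ≤ n − 1 only d < c,
-- d = n − 1 (one new occurrence) and d = n (none) survive, and removing a largest or
-- second-largest first letter again keeps the number of occurrences. Hence
--   u_r(n + 1; c) = Σ_{d<c} u_r(n; d) + #{σ ∈ S_{n−1} : occ σ + 1 = r} + u_r(n − 1),
-- where the middle term is u_0(n − 1) for r = 1 and 0 for r = 0. So the difference
-- D(n; c) = u_1(n; c) − u_0(n; c) satisfies D(n + 1; c) = u_1(n − 1) + Σ_{d<c} D(n; d), and by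
-- Pascal's rule so does the binomial sum of the statement.

module Submission where

open import Defs
open import Algebra.Properties.CommutativeSemigroup using (interchange)
open import Data.Bool using (if_then_else_)
open import Data.Empty using (⊥; ⊥-elim)
open import Data.List
  using (List; []; _∷_; [_]; _++_; length; filter; map; upTo; applyUpTo; cartesianProductWith; concatMap)
open import Data.List.Properties
  using ( length-map; filter-none; filter-accept; filter-reject; applyUpTo-∷ʳ
        ; map-injective; ∷-injective; ∷-injectiveʳ)
open import Data.List.Membership.Propositional using (_∈_)
open import Data.List.Membership.Propositional.Properties
  using ( ∈-filter⁻; ∈-filter⁺; ∈-map⁻; ∈-map⁺; ∈-applyUpTo⁻; ∈-applyUpTo⁺
        ; ∈-cartesianProductWith⁻; ∈-cartesianProductWith⁺)
open import Data.List.Membership.Propositional.Properties.WithK using (unique∧set⇒bag)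
open import Data.List.Relation.Binary.BagAndSetEquality using (_∼[_]_; set; ∼bag⇒↭)
open import Data.List.Relation.Binary.Permutation.Propositional using (_↭_)
open import Data.List.Relation.Binary.Permutation.Propositional.Properties using (↭-length; filter-↭)
open import Data.List.Relation.Unary.All as All using (All; []; _∷_)
import Data.List.Relation.Unary.All.Properties as All
open import Data.List.Relation.Unary.AllPairs using ([]; _∷_)
open import Data.List.Relation.Unary.Any using (here; there)
open import Data.List.Relation.Unary.Unique.Propositional using (Unique)
import Data.List.Relation.Unary.Unique.Propositional.Properties as Unique
open import Data.Nat
open import Data.Nat.Combinatorics using (_C_; nCk+nC[k+1]≡[n+1]C[k+1]; k>n⇒nCk≡0)
open import Data.Nat.ListAction using (sum)
open import Data.Nat.Properties
open import Data.Nat.Solver using (module +-*-Solver)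
open import Data.List.Relation.Unary.Unique.DecPropositional _≟_ using (unique?)
open import Data.Product using (∃-syntax; _×_; _,_; proj₁; proj₂; uncurry)
open import Data.Sum using (inj₁; inj₂)
open import Function using (_∘_; id; mk⇔)
open import Function.Definitions using (Injective)
open import Level using (0ℓ)
open import Relation.Binary.Definitions using (tri<; tri≈; tri>)
open import Relation.Binary.PropositionalEquality
  using (_≡_; _≢_; refl; sym; trans; cong; cong₂; subst; module ≡-Reasoning)
open import Relation.Nullary using (yes; no; ¬_; does)
open import Relation.Nullary.Decidable using (dec-true; dec-false)
open import Relation.Unary using (Pred; Decidable)
open import Relation.Unary.Properties using (_∩?_; ∁?)
open +-*-Solver using (solve; _:+_; _:=_)

-- Finite sums

sumTo : ℕ → (ℕ → ℕ) → ℕ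
sumTo zero    f = 0
sumTo (suc k) f = sumTo k f + f k

sumTo-cong : ∀ k {f g : ℕ → ℕ} → (∀ {j} → j < k → f j ≡ g j) → sumTo k f ≡ sumTo k g
sumTo-cong zero    f≗g = refl
sumTo-cong (suc k) f≗g = cong₂ _+_ (sumTo-cong k (f≗g ∘ m<n⇒m<1+n)) (f≗g ≤-refl)

sumTo-+ : ∀ k (f g : ℕ → ℕ) → sumTo k (λ j → f j + g j) ≡ sumTo k f + sumTo k g
sumTo-+ zero    f g = refl
sumTo-+ (suc k) f g = trans (cong (_+ (f k + g k)) (sumTo-+ k f g))
  (interchange +-commutativeSemigroup (sumTo k f) (sumTo k g) (f k) (g k))

sumTo-unfoldˡ : ∀ k (f : ℕ → ℕ) → sumTo (suc k) f ≡ f 0 + sumTo k (f ∘ suc)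
sumTo-unfoldˡ zero    f = +-comm 0 (f 0)
sumTo-unfoldˡ (suc k) f = trans (cong (_+ f (suc k)) (sumTo-unfoldˡ k f)) (+-assoc (f 0) _ _)

sumTo-truncate : ∀ {c} k (f : ℕ → ℕ) → c ≤ k → (∀ {j} → c ≤ j → j < k → f j ≡ 0) →
  sumTo k f ≡ sumTo c f
sumTo-truncate {c} k f c≤k f≡0 with m≤n⇒m<n∨m≡n c≤k
sumTo-truncate {c} (suc k) f _ f≡0 | inj₁ c<1+k = begin
  sumTo k f + f k
    ≡⟨ cong₂ _+_ (sumTo-truncate k f c≤k (λ c≤j j<k → f≡0 c≤j (m<n⇒m<1+n j<k))) (f≡0 c≤k ≤-refl) ⟩
  sumTo c f + 0
    ≡⟨ +-identityʳ (sumTo c f) ⟩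
  sumTo c f ∎
  where
  open ≡-Reasoning
  c≤k : c ≤ k
  c≤k = ≤-pred c<1+k
sumTo-truncate k f c≤k f≡0 | inj₂ refl = refl

sum-map-applyUpTo : ∀ k (f g : ℕ → ℕ) → sum (map f (applyUpTo g k)) ≡ sumTo k (f ∘ g)
sum-map-applyUpTo zero    f g = refl
sum-map-applyUpTo (suc k) f g =
  trans (cong (f (g 0) +_) (sum-map-applyUpTo k f (g ∘ suc))) (sym (sumTo-unfoldˡ k (f ∘ g)))

sum-map-upTo : ∀ k (f : ℕ → ℕ) → sum (map f (upTo k)) ≡ sumTo k f
sum-map-upTo k f = sum-map-applyUpTo k f id

sumTo-pascal : ∀ k (g : ℕ → ℕ) →
  sumTo (2 + k) (λ j → (suc k C j) * g j)
    ≡ sumTo (suc k) (λ j → (k C j) * g j) + sumTo (suc k) (λ j → (k C j) * g (suc j))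
sumTo-pascal k g = begin
  sumTo (2 + k) (λ j → (suc k C j) * g j)
    ≡⟨ sumTo-unfoldˡ (suc k) _ ⟩
  g 0 + 0 + sumTo (suc k) (λ j → (suc k C suc j) * g (suc j))
    ≡⟨ cong (g 0 + 0 +_) (trans (sumTo-cong (suc k) (λ {j} _ → pascal-term j)) (sumTo-+ (suc k) _ _)) ⟩
  g 0 + 0 + (A + B)
    ≡⟨ trans (cong (g 0 + 0 +_) (+-comm A B)) (sym (+-assoc (g 0 + 0) B A)) ⟩
  g 0 + 0 + B + A
    ≡⟨ cong (_+ A) (sym (sumTo-unfoldˡ (suc k) (λ j → (k C j) * g j))) ⟩
  sumTo (suc k) (λ j → (k C j) * g j) + (k C suc k) * g (suc k) + A
    ≡⟨ cong (λ x → sumTo (suc k) (λ j → (k C j) * g j) + x * g (suc k) + A) (k>n⇒nCk≡0 (n<1+n k)) ⟩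
  sumTo (suc k) (λ j → (k C j) * g j) + 0 + A
    ≡⟨ cong (_+ A) (+-identityʳ (sumTo (suc k) (λ j → (k C j) * g j))) ⟩
  sumTo (suc k) (λ j → (k C j) * g j) + A ∎
  where
  open ≡-Reasoning
  A B : ℕ
  A = sumTo (suc k) (λ j → (k C j) * g (suc j))
  B = sumTo (suc k) (λ j → (k C suc j) * g (suc j))
  pascal-term : ∀ j → (suc k C suc j) * g (suc j) ≡ (k C j) * g (suc j) + (k C suc j) * g (suc j)
  pascal-term j = trans (cong (_* g (suc j)) (sym (nCk+nC[k+1]≡[n+1]C[k+1] k j)))
                        (*-distribʳ-+ (g (suc j)) (k C j) (k C suc j))

binomSum : (ℕ → ℕ) → ℕ → ℕ → ℕ
binomSum f m k = sumTo k (λ j → ((k ∸ 1) C j) * f (m ∸ j))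

binomSum-suc : ∀ (f : ℕ → ℕ) m k →
  binomSum f (suc m) (suc k) ≡ f (suc m) + sumTo (suc k) (binomSum f m)
binomSum-suc f m zero    = refl
binomSum-suc f m (suc k) = begin
  binomSum f (suc m) (2 + k)
    ≡⟨ sumTo-pascal k (λ j → f (suc m ∸ j)) ⟩
  binomSum f (suc m) (suc k) + binomSum f m (suc k)
    ≡⟨ cong (_+ binomSum f m (suc k)) (binomSum-suc f m k) ⟩
  f (suc m) + sumTo (suc k) (binomSum f m) + binomSum f m (suc k)
    ≡⟨ +-assoc (f (suc m)) _ _ ⟩
  f (suc m) + sumTo (2 + k) (binomSum f m) ∎
  where open ≡-Reasoning

-- Counting by filtering

length-filter-none : {A : Set} {P : Pred A 0ℓ} (P? : Decidable P) (xs : List A) →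
  (∀ {x} → x ∈ xs → ¬ P x) → length (filter P? xs) ≡ 0
length-filter-none P? xs ¬P = cong length (filter-none P? (All.tabulate ¬P))

module _ {A : Set} {P Q : Pred A 0ℓ} (P? : Decidable P) (Q? : Decidable Q) where

  length-filter-split : ∀ xs →
    length (filter P? xs) ≡ length (filter (P? ∩? Q?) xs) + length (filter (P? ∩? ∁? Q?) xs)
  length-filter-split [] = refl
  length-filter-split (x ∷ xs) with P? x | Q? x
  ... | yes _ | yes _ = cong suc (length-filter-split xs)
  ... | yes _ | no  _ = trans (cong suc (length-filter-split xs)) (sym (+-suc _ _))
  ... | no  _ | yes _ = length-filter-split xs
  ... | no  _ | no  _ = length-filter-split xs

  length-filter-cong-∈ : ∀ xs →
    (∀ {x} → x ∈ xs → P x → Q x) → (∀ {x} → x ∈ xs → Q x → P x) →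
    length (filter P? xs) ≡ length (filter Q? xs)
  length-filter-cong-∈ [] P⇒Q Q⇒P = refl
  length-filter-cong-∈ (x ∷ xs) P⇒Q Q⇒P with P? x | Q? x
  ... | yes _  | yes _  = cong suc (length-filter-cong-∈ xs (P⇒Q ∘ there) (Q⇒P ∘ there))
  ... | yes px | no ¬qx = ⊥-elim (¬qx (P⇒Q (here refl) px))
  ... | no ¬px | yes qx = ⊥-elim (¬px (Q⇒P (here refl) qx))
  ... | no  _  | no  _  = length-filter-cong-∈ xs (P⇒Q ∘ there) (Q⇒P ∘ there)

module _ {A B : Set} {P : Pred A 0ℓ} {Q : Pred B 0ℓ} (P? : Decidable P) (Q? : Decidable Q) where

  length-filter-image : {xs : List A} {ys : List B} (g : B → A) → Injective _≡_ _≡_ g →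
    Unique xs → Unique ys →
    (∀ {y} → y ∈ ys → Q y → g y ∈ xs × P (g y)) →
    (∀ {x} → x ∈ xs → P x → ∃[ y ] y ∈ ys × Q y × g y ≡ x) →
    length (filter P? xs) ≡ length (filter Q? ys)
  length-filter-image {xs} {ys} g g-inj xs! ys! into onto =
    trans (↭-length (∼bag⇒↭ (unique∧set⇒bag (Unique.filter⁺ P? xs!) image! same)))
          (length-map g (filter Q? ys))
    where
    to : ∀ {x} → x ∈ filter P? xs → x ∈ map g (filter Q? ys)
    to x∈ with x∈xs , px ← ∈-filter⁻ P? x∈
      with y , y∈ys , qy , refl ← onto x∈xs px = ∈-map⁺ g (∈-filter⁺ Q? y∈ys qy)
    from : ∀ {x} → x ∈ map g (filter Q? ys) → x ∈ filter P? xs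
    from x∈ with y , y∈ , refl ← ∈-map⁻ g x∈
      with y∈ys , qy ← ∈-filter⁻ Q? y∈ = uncurry (∈-filter⁺ P?) (into y∈ys qy)
    same : filter P? xs ∼[ set ] map g (filter Q? ys)
    same = mk⇔ to from
    image! : Unique (map g (filter Q? ys))
    image! = Unique.map⁺ g-inj (Unique.filter⁺ Q? ys!)

-- Permutations of [n] as lists

InRange : ℕ → ℕ → Set
InRange n a = 1 ≤ a × a ≤ n

IsPermOf : ℕ → List ℕ → Set
IsPermOf n w = length w ≡ n × All (InRange n) w × Unique w

range1≡applyUpTo : ∀ n → range1 n ≡ applyUpTo suc n
range1≡applyUpTo zero    = refl
range1≡applyUpTo (suc n) = trans (cong (_++ [ suc n ]) (range1≡applyUpTo n)) (applyUpTo-∷ʳ suc n)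

∈-range1⁻ : ∀ {n a} → a ∈ range1 n → InRange n a
∈-range1⁻ {n} a∈ with j , j<n , refl ← ∈-applyUpTo⁻ suc (subst (_ ∈_) (range1≡applyUpTo n) a∈) =
  s≤s z≤n , j<n

∈-range1⁺ : ∀ {n a} → InRange n a → a ∈ range1 n
∈-range1⁺ {n} (s≤s z≤n , a≤n) = subst (_ ∈_) (sym (range1≡applyUpTo n)) (∈-applyUpTo⁺ suc a≤n)

range1-unique : ∀ n → Unique (range1 n)
range1-unique n = subst Unique (sym (range1≡applyUpTo n))
  (Unique.applyUpTo⁺₁ suc n (λ i<j _ → <⇒≢ i<j ∘ suc-injective))

words-suc : ∀ k n → words (suc k) n ≡ cartesianProductWith _∷_ (range1 n) (words k n)
words-suc k n = go (range1 n)
  where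
  go : ∀ as → concatMap (λ a → map (a ∷_) (words k n)) as ≡ cartesianProductWith _∷_ as (words k n)
  go []       = refl
  go (a ∷ as) = cong (map (a ∷_) (words k n) ++_) (go as)

∈-words⁻ : ∀ k n {w} → w ∈ words k n → length w ≡ k × All (InRange n) w
∈-words⁻ zero    n (here refl) = refl , []
∈-words⁻ (suc k) n w∈
  with a , v , a∈ , v∈ , refl ← ∈-cartesianProductWith⁻ _∷_ (range1 n) (words k n)
                                   (subst (_ ∈_) (words-suc k n) w∈)
  with |v|≡k , v-range ← ∈-words⁻ k n v∈ = cong suc |v|≡k , ∈-range1⁻ a∈ ∷ v-range

∈-words⁺ : ∀ k n {w} → length w ≡ k → All (InRange n) w → w ∈ words k n
∈-words⁺ zero    n {[]}    refl []           = here refl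
∈-words⁺ (suc k) n {a ∷ w} |w|≡k (a∈ ∷ w∈) = subst (_ ∈_) (sym (words-suc k n))
  (∈-cartesianProductWith⁺ _∷_ (∈-range1⁺ a∈) (∈-words⁺ k n (suc-injective |w|≡k) w∈))

words-unique : ∀ k n → Unique (words k n)
words-unique zero    n = [] ∷ []
words-unique (suc k) n = subst Unique (sym (words-suc k n))
  (Unique.cartesianProductWith⁺ _∷_ ∷-injective (range1-unique n) (words-unique k n))

∈-perms⁻ : ∀ n {w} → w ∈ perms n → IsPermOf n w
∈-perms⁻ n w∈ with w∈words , w! ← ∈-filter⁻ unique? w∈
  with |w| , w-range ← ∈-words⁻ n n w∈words = |w| , w-range , w!

∈-perms⁺ : ∀ {n w} → IsPermOf n w → w ∈ perms n
∈-perms⁺ {n} (|w| , w-range , w!) = ∈-filter⁺ unique? (∈-words⁺ n n |w| w-range) w!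

perms-unique : ∀ n → Unique (perms n)
perms-unique n = Unique.filter⁺ unique? (words-unique n n)

-- Strictly monotone relabelling

module StrictlyMonotone {f : ℕ → ℕ} (f-mono : ∀ {x y} → x < y → f x < f y) where

  reflects-< : ∀ {x y} → f x < f y → x < y
  reflects-< {x} {y} fx<fy with <-cmp x y
  ... | tri< x<y _ _    = x<y
  ... | tri≈ _ refl _   = ⊥-elim (<-irrefl refl fx<fy)
  ... | tri> _ _ y<x    = ⊥-elim (<-asym fx<fy (f-mono y<x))

  injective : Injective _≡_ _≡_ f
  injective {x} {y} fx≡fy with <-cmp x y
  ... | tri< x<y _ _ = ⊥-elim (<⇒≢ (f-mono x<y) fx≡fy)
  ... | tri≈ _ x≡y _ = x≡y
  ... | tri> _ _ y<x = ⊥-elim (<⇒≢ (f-mono y<x) (sym fx≡fy))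

  does-<-map : ∀ a b → does (f a <? f b) ≡ does (a <? b)
  does-<-map a b with a <? b
  ... | yes a<b = trans (dec-true (f a <? f b) (f-mono a<b)) (sym (dec-true (a <? b) a<b))
  ... | no  a≮b = trans (dec-false (f a <? f b) (a≮b ∘ reflects-<)) (sym (dec-false (a <? b) a≮b))

  countAbove-map : ∀ b r → countAbove (f b) (map f r) ≡ countAbove b r
  countAbove-map b []      = refl
  countAbove-map b (x ∷ r) with b <? x | f b <? f x
  ... | yes _   | yes _     = cong suc (countAbove-map b r)
  ... | yes b<x | no  fb≮fx = ⊥-elim (fb≮fx (f-mono b<x))
  ... | no  b≮x | yes fb<fx = ⊥-elim (b≮x (reflects-< fb<fx))
  ... | no  _   | no  _     = countAbove-map b r

  occFrom-map : ∀ a r → occFrom (f a) (map f r) ≡ occFrom a r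
  occFrom-map a []      = refl
  occFrom-map a (b ∷ r) = cong₂ _+_
    (cong₂ (λ t n → if t then n else 0) (does-<-map a b) (countAbove-map b r))
    (occFrom-map b r)

  occ12-3-map : ∀ w → occ12-3 (map f w) ≡ occ12-3 w
  occ12-3-map []      = refl
  occ12-3-map (a ∷ w) = occFrom-map a w

-- Prepending a first letter

punchIn : ℕ → ℕ → ℕ
punchIn c x with c ≤? x
... | yes _ = suc x
... | no  _ = x

punchOut : ℕ → ℕ → ℕ
punchOut c y with c <? y
... | yes _ = pred y
... | no  _ = y

punchIn-≥ : ∀ {c x} → c ≤ x → punchIn c x ≡ suc x
punchIn-≥ {c} {x} c≤x with c ≤? x
... | yes _   = refl
... | no  c≰x = ⊥-elim (c≰x c≤x)

punchIn-< : ∀ {c x} → x < c → punchIn c x ≡ x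
punchIn-< {c} {x} x<c with c ≤? x
... | yes c≤x = ⊥-elim (<⇒≱ x<c c≤x)
... | no  _   = refl

punchIn-mono-< : ∀ c {x y} → x < y → punchIn c x < punchIn c y
punchIn-mono-< c {x} {y} x<y with c ≤? x | c ≤? y
... | yes _   | yes _   = s≤s x<y
... | yes c≤x | no  c≰y = ⊥-elim (c≰y (≤-trans c≤x (<⇒≤ x<y)))
... | no  _   | yes _   = m<n⇒m<1+n x<y
... | no  _   | no  _   = x<y

punchIn≢ : ∀ c x → punchIn c x ≢ c
punchIn≢ c x with c ≤? x
... | yes c≤x = <⇒≢ (s≤s c≤x) ∘ sym
... | no  c≰x = c≰x ∘ ≤-reflexive ∘ sym

punchIn-punchOut : ∀ {c y} → c ≢ y → punchIn c (punchOut c y) ≡ y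
punchIn-punchOut {c} {y} c≢y with c <? y
punchIn-punchOut {c} {suc y} c≢y | yes (s≤s c≤y) = punchIn-≥ c≤y
... | no c≮y = punchIn-< (≤∧≢⇒< (≮⇒≥ c≮y) (c≢y ∘ sym))

punchIn-InRange : ∀ {n} c {x} → InRange n x → InRange (suc n) (punchIn c x)
punchIn-InRange c {x} (1≤x , x≤n) with c ≤? x
... | yes _ = s≤s z≤n , s≤s x≤n
... | no  _ = 1≤x , m≤n⇒m≤1+n x≤n

punchOut-InRange : ∀ {n c y} → InRange (suc n) c → c ≢ y → InRange (suc n) y → InRange n (punchOut c y)
punchOut-InRange {c = c} {y} (1≤c , c≤1+n) c≢y (1≤y , y≤1+n) with c <? y
punchOut-InRange {c = c} {suc y} (1≤c , _) c≢y (_ , y≤1+n) | yes (s≤s c≤y) =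
  ≤-trans 1≤c c≤y , ≤-pred y≤1+n
... | no c≮y = 1≤y , ≤-pred (≤-trans (≤∧≢⇒< (≮⇒≥ c≮y) (c≢y ∘ sym)) c≤1+n)

prepend : ℕ → List ℕ → List ℕ
prepend c w = c ∷ map (punchIn c) w

prepend-injective : ∀ c → Injective _≡_ _≡_ (prepend c)
prepend-injective c = map-injective (StrictlyMonotone.injective (punchIn-mono-< c)) ∘ ∷-injectiveʳ

IsPermOf-prepend : ∀ {n c w} → InRange (suc n) c → IsPermOf n w → IsPermOf (suc n) (prepend c w)
IsPermOf-prepend {c = c} {w} c-range (|w| , w-range , w!) =
  cong suc (trans (length-map (punchIn c) w) |w|) ,
  c-range ∷ All.map⁺ (All.map (punchIn-InRange c) w-range) ,
  All.map⁺ (All.universal (λ x → punchIn≢ c x ∘ sym) w) ∷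
    Unique.map⁺ (StrictlyMonotone.injective (punchIn-mono-< c)) w!

map-punchIn-punchOut : ∀ {c τ} → All (c ≢_) τ → map (punchIn c) (map (punchOut c) τ) ≡ τ
map-punchIn-punchOut []            = refl
map-punchIn-punchOut (c≢x ∷ c∉τ) = cong₂ _∷_ (punchIn-punchOut c≢x) (map-punchIn-punchOut c∉τ)

IsPermOf-unprepend : ∀ {n c τ} → IsPermOf (suc n) (c ∷ τ) →
  ∃[ w ] IsPermOf n w × prepend c w ≡ c ∷ τ
IsPermOf-unprepend {c = c} {τ} (|cτ| , c-range ∷ τ-range , c∉τ ∷ τ!) =
  map (punchOut c) τ ,
  (trans (length-map (punchOut c) τ) (suc-injective |cτ|) ,
   All.map⁺ (All.zipWith (λ (c≢y , y-range) → punchOut-InRange c-range c≢y y-range) (c∉τ , τ-range)) ,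
   Unique.map⁻ (subst Unique (sym punchIn-punchOut-τ) τ!)) ,
  cong (c ∷_) punchIn-punchOut-τ
  where
  punchIn-punchOut-τ : map (punchIn c) (map (punchOut c) τ) ≡ τ
  punchIn-punchOut-τ = map-punchIn-punchOut c∉τ

IsPermOf-complete : ∀ {n w v} → IsPermOf n w → InRange n v → v ∈ w
IsPermOf-complete {zero}  _ (1≤v , v≤0) = ⊥-elim (<⇒≱ 1≤v v≤0)
IsPermOf-complete {suc n} {c ∷ τ} {v} cτ-perm v-range with c ≟ v
... | yes refl = here refl
... | no  c≢v with w , w-perm , refl ← IsPermOf-unprepend cτ-perm =
  there (subst (_∈ map (punchIn c) w) (punchIn-punchOut c≢v)
    (∈-map⁺ (punchIn c) (IsPermOf-complete w-perm (punchOut-InRange c-range c≢v v-range))))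
  where
  c-range : InRange (suc n) c
  c-range = All.head (proj₁ (proj₂ cτ-perm))

IsPermOf⇒↭range1 : ∀ {n w} → IsPermOf n w → w ↭ range1 n
IsPermOf⇒↭range1 {n} w-perm@(_ , w-range , w!) = ∼bag⇒↭ (unique∧set⇒bag w! (range1-unique n)
  (mk⇔ (∈-range1⁺ ∘ All.lookup w-range) (IsPermOf-complete w-perm ∘ ∈-range1⁻)))

-- Occurrences of 12-3 after prepending

countAbove≡length-filter : ∀ b xs → countAbove b xs ≡ length (filter (b <?_) xs)
countAbove≡length-filter b []       = refl
countAbove≡length-filter b (x ∷ xs) with b <? x
... | yes b<x = trans (cong suc (countAbove≡length-filter b xs)) (cong length (sym (filter-accept (b <?_) b<x)))
... | no  b≮x = trans (countAbove≡length-filter b xs) (cong length (sym (filter-reject (b <?_) b≮x)))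

countAbove-range1 : ∀ b n → countAbove b (range1 n) ≡ n ∸ b
countAbove-range1 b zero    = sym (0∸n≡0 b)
countAbove-range1 b (suc n) = begin
  countAbove b (range1 n ++ [ suc n ])
    ≡⟨ countAbove-++ (range1 n) ⟩
  countAbove b (range1 n) + countAbove b [ suc n ]
    ≡⟨ cong (_+ countAbove b [ suc n ]) (countAbove-range1 b n) ⟩
  n ∸ b + countAbove b [ suc n ]
    ≡⟨ last ⟩
  suc n ∸ b ∎
  where
  open ≡-Reasoning
  countAbove-++ : ∀ xs {ys} → countAbove b (xs ++ ys) ≡ countAbove b xs + countAbove b ys
  countAbove-++ []       = refl
  countAbove-++ (x ∷ xs) with b <? x
  ... | yes _ = cong suc (countAbove-++ xs)
  ... | no  _ = countAbove-++ xs
  last : n ∸ b + countAbove b [ suc n ] ≡ suc n ∸ b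
  last with b <? suc n
  ... | yes (s≤s b≤n) = trans (+-comm (n ∸ b) 1) (sym (+-∸-assoc 1 b≤n))
  ... | no  b≮1+n     = trans (+-identityʳ (n ∸ b))
    (trans (m≤n⇒m∸n≡0 (≤-trans (n≤1+n n) (≮⇒≥ b≮1+n))) (sym (m≤n⇒m∸n≡0 (≮⇒≥ b≮1+n))))

countAbove-IsPermOf : ∀ {n w} b → IsPermOf n w → countAbove b w ≡ n ∸ b
countAbove-IsPermOf {n} {w} b w-perm = begin
  countAbove b w                          ≡⟨ countAbove≡length-filter b w ⟩
  length (filter (b <?_) w)               ≡⟨ ↭-length (filter-↭ (b <?_) (IsPermOf⇒↭range1 w-perm)) ⟩
  length (filter (b <?_) (range1 n))      ≡⟨ countAbove≡length-filter b (range1 n) ⟨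
  countAbove b (range1 n)                 ≡⟨ countAbove-range1 b n ⟩
  n ∸ b                                   ∎
  where open ≡-Reasoning

occ12-3-∷-≮ : ∀ {a b} r → ¬ a < b → occ12-3 (a ∷ b ∷ r) ≡ occ12-3 (b ∷ r)
occ12-3-∷-≮ {a} {b} r a≮b =
  cong (λ t → (if t then countAbove b r else 0) + occFrom b r) (dec-false (a <? b) a≮b)

occ12-3-∷-< : ∀ {a b} r → a < b → occ12-3 (a ∷ b ∷ r) ≡ countAbove b r + occ12-3 (b ∷ r)
occ12-3-∷-< {a} {b} r a<b =
  cong (λ t → (if t then countAbove b r else 0) + occFrom b r) (dec-true (a <? b) a<b)

countAbove-∷-≮ : ∀ {b x} r → ¬ b < x → countAbove b (x ∷ r) ≡ countAbove b r
countAbove-∷-≮ {b} {x} r b≮x with b <? x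
... | yes b<x = ⊥-elim (b≮x b<x)
... | no  _   = refl

occ12-3-prepend-< : ∀ {c d} w → d < c → occ12-3 (prepend c (d ∷ w)) ≡ occ12-3 (d ∷ w)
occ12-3-prepend-< {c} {d} w d<c = begin
  occ12-3 (c ∷ punchIn c d ∷ map (punchIn c) w)
    ≡⟨ occ12-3-∷-≮ (map (punchIn c) w) (<-asym d<c ∘ subst (c <_) (punchIn-< d<c)) ⟩
  occ12-3 (map (punchIn c) (d ∷ w))
    ≡⟨ StrictlyMonotone.occ12-3-map (punchIn-mono-< c) (d ∷ w) ⟩
  occ12-3 (d ∷ w) ∎
  where open ≡-Reasoning

occ12-3-prepend-≥ : ∀ {n c d} w → c ≤ d → IsPermOf n (d ∷ w) →
  occ12-3 (prepend c (d ∷ w)) ≡ n ∸ d + occ12-3 (d ∷ w)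
occ12-3-prepend-≥ {n} {c} {d} w c≤d dw-perm = begin
  occ12-3 (c ∷ punchIn c d ∷ map (punchIn c) w)
    ≡⟨ occ12-3-∷-< (map (punchIn c) w) (subst (c <_) (sym (punchIn-≥ c≤d)) (s≤s c≤d)) ⟩
  countAbove (punchIn c d) (map (punchIn c) w) + occ12-3 (map (punchIn c) (d ∷ w))
    ≡⟨ cong₂ _+_ (countAbove-map d w) (occ12-3-map (d ∷ w)) ⟩
  countAbove d w + occ12-3 (d ∷ w)
    ≡⟨ cong (_+ occ12-3 (d ∷ w)) (countAbove-∷-≮ w (<-irrefl refl)) ⟨
  countAbove d (d ∷ w) + occ12-3 (d ∷ w)
    ≡⟨ cong (_+ occ12-3 (d ∷ w)) (countAbove-IsPermOf d dw-perm) ⟩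
  n ∸ d + occ12-3 (d ∷ w) ∎
  where
  open ≡-Reasoning
  open StrictlyMonotone (punchIn-mono-< c)

occ12-3-prepend-top : ∀ {n c w} → n ≤ c → IsPermOf n w → occ12-3 (prepend c w) ≡ occ12-3 w
occ12-3-prepend-top {w = []}    _   _ = refl
occ12-3-prepend-top {n} {c} {d ∷ w} n≤c dw-perm@(_ , (_ , d≤n) ∷ _ , _)
  with m≤n⇒m<n∨m≡n (≤-trans d≤n n≤c)
... | inj₁ d<c  = occ12-3-prepend-< w d<c
... | inj₂ refl =
  trans (occ12-3-prepend-≥ w ≤-refl dw-perm) (cong (_+ occ12-3 (d ∷ w)) (m≤n⇒m∸n≡0 n≤c))

-- Counting permutations

FirstBelow : ℕ → Pred (List ℕ) 0ℓ
FirstBelow k []      = ⊥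
FirstBelow k (a ∷ _) = a < k

firstBelow? : ∀ k → Decidable (FirstBelow k)
firstBelow? k []      = no λ ()
firstBelow? k (a ∷ _) = a <? k

length-filter-firstBelow : ∀ {P : Pred (List ℕ) 0ℓ} (P? : Decidable P) k xs →
  length (filter (P? ∩? firstBelow? k) xs) ≡ sumTo k (λ d → length (filter (P? ∩? firstIs? d) xs))
length-filter-firstBelow     P? zero    xs = length-filter-none _ xs (λ {w} _ → nothing-below-0 w ∘ proj₂)
  where
  nothing-below-0 : ∀ w → ¬ FirstBelow 0 w
  nothing-below-0 (_ ∷ _) ()
length-filter-firstBelow {P} P? (suc k) xs = begin
  length (filter (P? ∩? firstBelow? (suc k)) xs)
    ≡⟨ length-filter-split _ (firstBelow? k) xs ⟩
  length (filter ((P? ∩? firstBelow? (suc k)) ∩? firstBelow? k) xs)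
    + length (filter ((P? ∩? firstBelow? (suc k)) ∩? ∁? (firstBelow? k)) xs)
    ≡⟨ cong₂ _+_ (length-filter-cong-∈ _ _ xs (λ _ → below-k) (λ _ → below-k⁻¹))
                 (length-filter-cong-∈ _ _ xs (λ _ → first-k) (λ _ → first-k⁻¹)) ⟩
  length (filter (P? ∩? firstBelow? k) xs) + length (filter (P? ∩? firstIs? k) xs)
    ≡⟨ cong (_+ length (filter (P? ∩? firstIs? k) xs)) (length-filter-firstBelow P? k xs) ⟩
  sumTo (suc k) (λ d → length (filter (P? ∩? firstIs? d) xs)) ∎
  where
  open ≡-Reasoning
  below-k : ∀ {x} → ((P x × FirstBelow (suc k) x) × FirstBelow k x) → P x × FirstBelow k x
  below-k ((px , _) , x<k) = px , x<k
  below-k⁻¹ : ∀ {x} → P x × FirstBelow k x → ((P x × FirstBelow (suc k) x) × FirstBelow k x)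
  below-k⁻¹ {a ∷ _} (px , a<k) = (px , m<n⇒m<1+n a<k) , a<k
  first-k : ∀ {x} → ((P x × FirstBelow (suc k) x) × ¬ FirstBelow k x) → P x × FirstIs k x
  first-k {a ∷ _} ((px , a<1+k) , a≮k) = px , ≤-antisym (≤-pred a<1+k) (≮⇒≥ a≮k)
  first-k⁻¹ : ∀ {x} → P x × FirstIs k x → ((P x × FirstBelow (suc k) x) × ¬ FirstBelow k x)
  first-k⁻¹ {[]}    (_  , (refl , ()))
  first-k⁻¹ {_ ∷ _} (px , refl) = (px , ≤-refl) , <-irrefl refl

#perms : {P : Pred (List ℕ) 0ℓ} → Decidable P → ℕ → ℕ
#perms P? n = length (filter P? (perms n))

module _ {P : Pred (List ℕ) 0ℓ} (P? : Decidable P) where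

  #perms-by-first : ∀ n → #perms P? (suc n) ≡ sumTo (2 + n) (λ d → #perms (P? ∩? firstIs? d) (suc n))
  #perms-by-first n = trans
    (length-filter-cong-∈ P? (P? ∩? firstBelow? (2 + n)) (perms (suc n))
                          (λ w∈ pw → pw , first-below w∈) (λ _ → proj₁))
    (length-filter-firstBelow P? (2 + n) (perms (suc n)))
    where
    first-below : ∀ {w} → w ∈ perms (suc n) → FirstBelow (2 + n) w
    first-below {[]}    w∈ with () ← proj₁ (∈-perms⁻ (suc n) w∈)
    first-below {_ ∷ _} w∈ with (_ , a≤1+n) ∷ _ ← proj₁ (proj₂ (∈-perms⁻ (suc n) w∈)) =
      s≤s a≤1+n

  #perms-prepend : ∀ {n c} → InRange (suc n) c →
    #perms (P? ∩? firstIs? c) (suc n) ≡ #perms (P? ∘ prepend c) n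
  #perms-prepend {n} {c} c-range = length-filter-image _ _ (prepend c) (prepend-injective c)
    (perms-unique (suc n)) (perms-unique n) into onto
    where
    into : ∀ {w} → w ∈ perms n → P (prepend c w) →
      prepend c w ∈ perms (suc n) × (P (prepend c w) × FirstIs c (prepend c w))
    into w∈ p = ∈-perms⁺ (IsPermOf-prepend c-range (∈-perms⁻ n w∈)) , p , refl
    onto : ∀ {x} → x ∈ perms (suc n) → P x × FirstIs c x →
      ∃[ w ] w ∈ perms n × P (prepend c w) × prepend c w ≡ x
    onto {[]}     x∈ (_ , (refl , ()))
    onto {_ ∷ τ} x∈ (px , refl) with w , w-perm , refl ← IsPermOf-unprepend (∈-perms⁻ (suc n) x∈) =
      w , ∈-perms⁺ w-perm , px , refl

-- The recursion for u_r(n; c)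

#perms-occ12-3-top : ∀ {Q : Pred ℕ 0ℓ} (Q? : Decidable Q) {n c} → 1 ≤ c → n ≤ c → c ≤ suc n →
  #perms ((Q? ∘ occ12-3) ∩? firstIs? c) (suc n) ≡ #perms (Q? ∘ occ12-3) n
#perms-occ12-3-top {Q} Q? {n} {c} 1≤c n≤c c≤1+n = trans (#perms-prepend (Q? ∘ occ12-3) (1≤c , c≤1+n))
  (length-filter-cong-∈ _ _ (perms n) (subst Q ∘ occ-top) (subst Q ∘ sym ∘ occ-top))
  where
  occ-top : ∀ {w} → w ∈ perms n → occ12-3 (prepend c w) ≡ occ12-3 w
  occ-top w∈ = occ12-3-prepend-top n≤c (∈-perms⁻ n w∈)

#perms-occ12-3-prepend : ∀ {Q : Pred ℕ 0ℓ} (Q? : Decidable Q) n {c d} k →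
  (∀ {w} → IsPermOf n (d ∷ w) → occ12-3 (prepend c (d ∷ w)) ≡ k + occ12-3 (d ∷ w)) →
  #perms ((Q? ∘ occ12-3 ∘ prepend c) ∩? firstIs? d) n
    ≡ #perms ((Q? ∘ (k +_) ∘ occ12-3) ∩? firstIs? d) n
#perms-occ12-3-prepend {Q} Q? n {c} {d} k shift = length-filter-cong-∈ _ _ (perms n) to from
  where
  to : ∀ {w} → w ∈ perms n →
    Q (occ12-3 (prepend c w)) × FirstIs d w → Q (k + occ12-3 w) × FirstIs d w
  to {[]}    _  (_ , (refl , ()))
  to {_ ∷ _} w∈ (q , refl) = subst Q (shift (∈-perms⁻ n w∈)) q , refl
  from : ∀ {w} → w ∈ perms n →
    Q (k + occ12-3 w) × FirstIs d w → Q (occ12-3 (prepend c w)) × FirstIs d w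
  from {[]}    _  (_ , (refl , ()))
  from {_ ∷ _} w∈ (q , refl) = subst Q (sym (shift (∈-perms⁻ n w∈))) q , refl

u'-recurrence : ∀ r n c → r ≤ 1 → 1 ≤ c → c ≤ n →
  u' r (2 + n) c ≡ sumTo c (u' r (suc n)) + (#perms (λ w → suc (occ12-3 w) ≟ r) n + u r n)
u'-recurrence r n c r≤1 1≤c c≤n = begin
  u' r (2 + n) c
    ≡⟨ #perms-prepend (λ w → occ12-3 w ≟ r) (1≤c , m≤n⇒m≤1+n (m≤n⇒m≤1+n c≤n)) ⟩
  #perms (λ w → occ12-3 (prepend c w) ≟ r) (suc n)
    ≡⟨ #perms-by-first _ n ⟩
  sumTo n F + F n + F (suc n)
    ≡⟨ cong (λ s → s + F n + F (suc n)) (sumTo-truncate n F c≤n F-middle) ⟩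
  sumTo c F + F n + F (suc n)
    ≡⟨ cong (λ s → s + F n + F (suc n)) (sumTo-cong c F-below) ⟩
  sumTo c (u' r (suc n)) + F n + F (suc n)
    ≡⟨ cong₂ (λ s t → sumTo c (u' r (suc n)) + s + t) F-second F-last ⟩
  sumTo c (u' r (suc n)) + #perms (λ w → suc (occ12-3 w) ≟ r) n + u r n
    ≡⟨ +-assoc (sumTo c (u' r (suc n))) _ _ ⟩
  sumTo c (u' r (suc n)) + (#perms (λ w → suc (occ12-3 w) ≟ r) n + u r n) ∎
  where
  open ≡-Reasoning
  F : ℕ → ℕ
  F d = #perms ((λ w → occ12-3 (prepend c w) ≟ r) ∩? firstIs? d) (suc n)
  F-below : ∀ {d} → d < c → F d ≡ u' r (suc n) d
  F-below d<c = #perms-occ12-3-prepend (_≟ r) (suc n) 0 (λ {w} _ → occ12-3-prepend-< w d<c)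
  F-middle : ∀ {d} → c ≤ d → d < n → F d ≡ 0
  F-middle {d} c≤d d<n = trans
    (#perms-occ12-3-prepend (_≟ r) (suc n) (suc n ∸ d) (λ {w} → occ12-3-prepend-≥ w c≤d))
    (length-filter-none _ (perms (suc n)) λ _ (o , _) →
      <⇒≱ (s≤s r≤1) (subst (2 ≤_) o (≤-trans two≤ (m≤m+n _ _))))
    where
    two≤ : 2 ≤ suc n ∸ d
    two≤ = subst (_≤ suc n ∸ d) (m+n∸n≡m 2 d) (∸-monoˡ-≤ d (s≤s d<n))
  F-second : F n ≡ #perms (λ w → suc (occ12-3 w) ≟ r) n
  F-second = trans
    (#perms-occ12-3-prepend (_≟ r) (suc n) 1 (λ {w} perm →
      trans (occ12-3-prepend-≥ w c≤n perm) (cong (_+ occ12-3 (n ∷ w)) (m+n∸n≡m 1 n))))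
    (#perms-occ12-3-top (λ o → suc o ≟ r) (≤-trans 1≤c c≤n) ≤-refl (n≤1+n n))
  F-last : F (suc n) ≡ u r n
  F-last = trans
    (#perms-occ12-3-prepend (_≟ r) (suc n) 0 (λ {w} perm →
      trans (occ12-3-prepend-≥ w (m≤n⇒m≤1+n c≤n) perm) (cong (_+ occ12-3 (suc n ∷ w)) (n∸n≡0 n))))
    (#perms-occ12-3-top (_≟ r) (≤-trans 1≤c (m≤n⇒m≤1+n c≤n)) (n≤1+n n) ≤-refl)

u'-first-0 : ∀ r n → u' r n 0 ≡ 0
u'-first-0 r n = length-filter-none _ (perms n) first≢0
  where
  first≢0 : ∀ {w} → w ∈ perms n → ¬ (occ12-3 w ≡ r × FirstIs 0 w)
  first≢0 {[]}    _  (_ , (_ , ()))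
  first≢0 {_ ∷ _} w∈ (_ , refl) with (() , _) ∷ _ ← proj₁ (proj₂ (∈-perms⁻ n w∈))

DifferenceFormula : ℕ → ℕ → Set
DifferenceFormula n c = u' 1 n c ≡ binomSum (u 1) (n ∸ 2) c + u' 0 n c

differenceFormula-step : ∀ m k → k ≤ m → (∀ d → d ≤ m → DifferenceFormula (2 + m) d) →
  DifferenceFormula (3 + m) (suc k)
differenceFormula-step m k k≤m IH = begin
  u' 1 (2 + n) c
    ≡⟨ u'-recurrence 1 n c (s≤s z≤n) (s≤s z≤n) (s≤s k≤m) ⟩
  sumTo c (u' 1 (suc n)) + (#perms (λ w → suc (occ12-3 w) ≟ 1) n + u 1 n)
    ≡⟨ cong₂ (λ s e → s + (e + u 1 n)) (trans (sumTo-cong c IH<c) (sumTo-+ c _ _)) shifted₁ ⟩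
  sumTo c (binomSum (u 1) m) + sumTo c (u' 0 (suc n)) + (u 0 n + u 1 n)
    ≡⟨ solve 4 (λ b s u₀ u₁ → (b :+ s) :+ (u₀ :+ u₁) := (u₁ :+ b) :+ (s :+ u₀)) refl
         (sumTo c (binomSum (u 1) m)) (sumTo c (u' 0 (suc n))) (u 0 n) (u 1 n) ⟩
  u 1 n + sumTo c (binomSum (u 1) m) + (sumTo c (u' 0 (suc n)) + u 0 n)
    ≡⟨ cong₂ _+_ (binomSum-suc (u 1) m k)
                 (cong (λ e → sumTo c (u' 0 (suc n)) + (e + u 0 n)) shifted₀) ⟨
  binomSum (u 1) n c + (sumTo c (u' 0 (suc n)) + (#perms (λ w → suc (occ12-3 w) ≟ 0) n + u 0 n))
    ≡⟨ cong (binomSum (u 1) n c +_) (u'-recurrence 0 n c z≤n (s≤s z≤n) (s≤s k≤m)) ⟨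
  binomSum (u 1) n c + u' 0 (2 + n) c ∎
  where
  open ≡-Reasoning
  n c : ℕ
  n = suc m
  c = suc k
  IH<c : ∀ {d} → d < c → DifferenceFormula (suc n) d
  IH<c {d} d<c = IH d (≤-trans (≤-pred d<c) k≤m)
  shifted₁ : #perms (λ w → suc (occ12-3 w) ≟ 1) n ≡ u 0 n
  shifted₁ = length-filter-cong-∈ _ _ (perms n) (λ _ → suc-injective) (λ _ → cong suc)
  shifted₀ : #perms (λ w → suc (occ12-3 w) ≟ 0) n ≡ 0
  shifted₀ = length-filter-none _ (perms n) λ _ ()

differenceFormula : ∀ n c → c ≤ n ∸ 2 → DifferenceFormula n c
differenceFormula n                   zero    _         = trans (u'-first-0 1 n) (sym (u'-first-0 0 n))
differenceFormula (suc (suc (suc m))) (suc k) (s≤s k≤m) =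
  differenceFormula-step m k k≤m (differenceFormula (suc (suc m)))

lemma4 : (n i : ℕ) → 1 ≤ i → i ≤ n ∸ 2 →
    u' 1 n i ≡ sum (map (λ j → ((i ∸ 1) C j) * u 1 (n ∸ 2 ∸ j)) (upTo i)) + u' 0 n i
lemma4 n i _ i≤n∸2 = trans (differenceFormula n i i≤n∸2)
  (cong (_+ u' 0 n i) (sym (sum-map-upTo i (λ j → ((i ∸ 1) C j) * u 1 (n ∸ 2 ∸ j)))))
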